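{- Let $a,b\in\mathbb{N}$ (non-negative integers). Then \[ \min \mathcal{D}_{\geq 0}\begin{pmatrix} 0 & a\\ b & 0\end{pmatrix}=\min\left\{\Big(d,\max\big(1,\big\lceil \tfrac{ab}{d}\big\rceil\big)\Big)\ \Big|\ d\in\mathbb{N}_+,\ d\le \max(1,ab)\right\}. \]
   Context: $\mathbb{N}_+$ denotes the positive integers. A real square Z-matrix (off-diagonal entries $\le 0$) is an almost non-singular $M$-matrix if all its proper principal minors are positive and its determinant is non-negative. For a non-negative integer $n\times n$ matrix $L$ with zero diagonal, $\mathcal{D}_{\ge 0}(L)=\{\mathbf{d}\in\mathbb{N}_+^n \mid \mathrm{Diag}(\mathbf{d})-L \text{ is an almost non-singular } M\text{ -matrix}\}$. For a subset $S\subseteq\mathbb{N}^n$, $\min S$ is the set of minimal elements of $S$ with respect to the componentwise partial order ($\mathbf{x}\le\mathbf{y}$ iff $x_i\le y_i$ for all $i$). -}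

module Defs where

open import Data.Nat as ℕ using (ℕ; zero; suc; _⊔_)
open import Data.Nat.DivMod using (_/_)
open import Data.Fin using (Fin; zero; suc; punchIn; _≟_; _<_)
open import Data.Integer as ℤ using (ℤ; +_; 0ℤ; 1ℤ)
open import Data.Vec using (Vec; []; _∷_; lookup)
open import Data.Vec.Relation.Binary.Pointwise.Inductive using (Pointwise)
open import Data.Product using (_×_; Σ; ∃)
open import Relation.Binary.PropositionalEquality using (_≡_; _≢_)
open import Relation.Nullary.Decidable using (does)
open import Data.Bool using (if_then_else_)

Matrix : ℕ → Set
Matrix n = Fin n → Fin n → ℤ

altSum : ∀ {n} → (Fin (suc n) → ℤ) → ℤ
altSum {zero}  f = f zero
altSum {suc n} f = f zero ℤ.- altSum (λ j → f (suc j))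

det : ∀ {n} → Matrix n → ℤ
det {zero}  M = 1ℤ
det {suc n} M = altSum (λ j → M zero j ℤ.* det (λ i k → M (suc i) (punchIn j k)))

StrictlyIncreasing : ∀ {k n} → (Fin k → Fin n) → Set
StrictlyIncreasing f = ∀ i j → i < j → f i < f j

principalSub : ∀ {k n} → Matrix n → (Fin k → Fin n) → Matrix k
principalSub M f i j = M (f i) (f j)

IsZMatrix : ∀ {n} → Matrix n → Set
IsZMatrix M = ∀ i j → i ≢ j → M i j ℤ.≤ 0ℤ

IsAlmostNonsingularM : ∀ {n} → Matrix n → Set
IsAlmostNonsingularM {n} M =
  IsZMatrix M
  × (∀ k → k ℕ.< n → (f : Fin k → Fin n) → StrictlyIncreasing f →
       0ℤ ℤ.< det (principalSub M f))
  × 0ℤ ℤ.≤ det M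

diagMinus : ∀ {n} → Vec ℕ n → (Fin n → Fin n → ℕ) → Matrix n
diagMinus d L i j = (if does (i ≟ j) then + lookup d i else 0ℤ) ℤ.- + L i j

D≥0 : ∀ {n} → (Fin n → Fin n → ℕ) → Vec ℕ n → Set
D≥0 L d = (∀ i → 0 ℕ.< lookup d i) × IsAlmostNonsingularM (diagMinus d L)

_≤ᵥ_ : ∀ {n} → Vec ℕ n → Vec ℕ n → Set
_≤ᵥ_ = Pointwise ℕ._≤_

Min : ∀ {n} → (Vec ℕ n → Set) → Vec ℕ n → Set
Min S x = S x × (∀ y → S y → y ≤ᵥ x → y ≡ x)

L2 : ℕ → ℕ → Fin 2 → Fin 2 → ℕ
L2 a b zero    zero    = 0
L2 a b zero    (suc _) = a
L2 a b (suc _) zero    = b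
L2 a b (suc _) (suc _) = 0

-- ceiling division ⌈m / d⌉ (d ≥ 1; value at d = 0 irrelevant)
ceilDiv : ℕ → ℕ → ℕ
ceilDiv m zero    = 0
ceilDiv m (suc k) = (m ℕ.+ k) / suc k

RHSSet : ℕ → ℕ → Vec ℕ 2 → Set
RHSSet a b x = Σ ℕ λ d → (1 ℕ.≤ d) × (d ℕ.≤ 1 ⊔ (a ℕ.* b))
                 × (x ≡ d ∷ (1 ⊔ ceilDiv (a ℕ.* b) d) ∷ [])

{-# OPTIONS --safe #-}
module Submission where

open import Defs
open import Data.Nat as ℕ using (ℕ; zero; suc; _⊔_; z≤n; s≤s; s≤s⁻¹)
open import Data.Nat.Properties
open import Data.Nat.DivMod using (_/_; _%_; m≡m%n+[m/n]*n; m%n<n; m<n*o⇒m/o<n)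
open import Data.Vec using (Vec; []; _∷_; lookup)
open import Data.Vec.Relation.Binary.Pointwise.Inductive using ([]; _∷_)
import Data.Vec.Relation.Binary.Pointwise.Inductive as Pointwise
open import Data.Fin using (Fin; zero; suc)
open import Data.Integer as ℤ using (+_; 0ℤ; 1ℤ; _-_; _*_; +≤+; +<+; -≤+)
open import Data.Integer.Properties using (pos-*; drop‿+≤+; 0≤i-j⇒j≤i; i≤j⇒0≤j-i)
open import Data.Integer.Tactic.RingSolver using (solve-∀)
open import Data.Product using (_×_; ∃; _,_)
open import Data.Empty using (⊥-elim)
open import Relation.Nullary using (yes; no)
open import Relation.Binary.PropositionalEquality

-- A vector d lies in 𝒟_{≥0}(L2 a b) exactly when d₁, d₂ ≥ 1 and a b ≤ d₁ d₂, since the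
-- only proper principal minors are d₁ and d₂ and the determinant is d₁ d₂ − a b.  The
-- right-hand set is contained in this region, and every point of the region dominates a
-- point of it: lower d₁ to at most max(1, a b), then d₂ to max(1, ⌈a b / d₁⌉).  Two sets
-- related in this way have the same minimal elements.

≤ᵥ-trans : ∀ {n} {x y z : Vec ℕ n} → x ≤ᵥ y → y ≤ᵥ z → x ≤ᵥ z
≤ᵥ-trans = Pointwise.trans ≤-trans

≤ᵥ-antisym : ∀ {n} {x y : Vec ℕ n} → x ≤ᵥ y → y ≤ᵥ x → x ≡ y
≤ᵥ-antisym []         []         = refl
≤ᵥ-antisym (p ∷ ps) (q ∷ qs) = cong₂ _∷_ (≤-antisym p q) (≤ᵥ-antisym ps qs)

Min-cofinal : ∀ {n} {S T : Vec ℕ n → Set} →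
  (∀ {y} → T y → S y) → (∀ {y} → S y → ∃ λ z → T z × z ≤ᵥ y) →
  ∀ x → (Min S x → Min T x) × (Min T x → Min S x)
Min-cofinal {S = S} {T} T⊆S S⊆↑T x = minS⇒minT , minT⇒minS
  where
  minS⇒minT : Min S x → Min T x
  minS⇒minT (Sx , minimal) with S⊆↑T Sx
  ... | z , Tz , z≤x with minimal z (T⊆S Tz) z≤x
  ...   | refl = Tz , λ y Ty y≤x → minimal y (T⊆S Ty) y≤x

  minT⇒minS : Min T x → Min S x
  minT⇒minS (Tx , minimal) = T⊆S Tx , squeeze
    where
    squeeze : ∀ y → S y → y ≤ᵥ x → y ≡ x
    squeeze y Sy y≤x with S⊆↑T Sy
    ... | z , Tz , z≤y with minimal z Tz (≤ᵥ-trans z≤y y≤x)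
    ...   | refl = ≤ᵥ-antisym y≤x z≤y

≤-*-ceilDiv : ∀ m {d} → 1 ℕ.≤ d → m ℕ.≤ d ℕ.* ceilDiv m d
≤-*-ceilDiv m {suc k} _ = subst (m ℕ.≤_) (*-comm q (suc k)) (+-cancelˡ-≤ k m (q ℕ.* suc k) k+m≤k+q*d)
  where
  q = (m ℕ.+ k) / suc k
  k+m≤k+q*d : k ℕ.+ m ℕ.≤ k ℕ.+ q ℕ.* suc k
  k+m≤k+q*d = begin
    k ℕ.+ m                           ≡⟨ +-comm k m ⟩
    m ℕ.+ k                           ≡⟨ m≡m%n+[m/n]*n (m ℕ.+ k) (suc k) ⟩
    (m ℕ.+ k) % suc k ℕ.+ q ℕ.* suc k ≤⟨ +-monoˡ-≤ (q ℕ.* suc k) (s≤s⁻¹ (m%n<n (m ℕ.+ k) (suc k))) ⟩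
    k ℕ.+ q ℕ.* suc k                 ∎
    where open ≤-Reasoning

ceilDiv-least : ∀ m {d} → 1 ℕ.≤ d → ∀ e → m ℕ.≤ d ℕ.* e → ceilDiv m d ℕ.≤ e
ceilDiv-least m {suc k} _ e m≤d*e = s≤s⁻¹ (m<n*o⇒m/o<n {m ℕ.+ k} {suc e} {suc k} (s≤s m+k≤k+e*d))
  where
  m+k≤k+e*d : m ℕ.+ k ℕ.≤ k ℕ.+ e ℕ.* suc k
  m+k≤k+e*d = begin
    m ℕ.+ k           ≡⟨ +-comm m k ⟩
    k ℕ.+ m           ≤⟨ +-monoʳ-≤ k (subst (m ℕ.≤_) (*-comm (suc k) e) m≤d*e) ⟩
    k ℕ.+ e ℕ.* suc k ∎
    where open ≤-Reasoning

AboveHyperbola : ℕ → Vec ℕ 2 → Set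
AboveHyperbola m (d₁ ∷ d₂ ∷ []) = 1 ℕ.≤ d₁ × 1 ℕ.≤ d₂ × m ℕ.≤ d₁ ℕ.* d₂

det-diagMinus-L2 : ∀ a b d₁ d₂ →
  det (diagMinus (d₁ ∷ d₂ ∷ []) (L2 a b)) ≡ + (d₁ ℕ.* d₂) - + (a ℕ.* b)
det-diagMinus-L2 a b d₁ d₂ rewrite pos-* d₁ d₂ | pos-* a b = expand (+ d₁) (+ d₂) (+ a) (+ b)
  where
  -- the left-hand side is what the Laplace expansion of the 2 × 2 determinant unfolds to
  expand : ∀ x y z w → (x - 0ℤ) * ((y - 0ℤ) * 1ℤ) - ((0ℤ - z) * ((0ℤ - w) * 1ℤ)) ≡ x * y - z * w
  expand = solve-∀

D≥0-L2⇒AboveHyperbola : ∀ a b {x} → D≥0 (L2 a b) x → AboveHyperbola (a ℕ.* b) x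
D≥0-L2⇒AboveHyperbola a b {d₁ ∷ d₂ ∷ []} (positive , _ , _ , det≥0) =
  positive zero , positive (suc zero) ,
  drop‿+≤+ (0≤i-j⇒j≤i (subst (0ℤ ℤ.≤_) (det-diagMinus-L2 a b d₁ d₂) det≥0))

AboveHyperbola⇒D≥0-L2 : ∀ a b {x} → AboveHyperbola (a ℕ.* b) x → D≥0 (L2 a b) x
AboveHyperbola⇒D≥0-L2 a b {suc m ∷ suc n ∷ []} (_ , _ , ab≤d₁d₂) =
  positive , zMatrix , properMinors , det≥0
  where
  d = suc m ∷ suc n ∷ []
  M = diagMinus d (L2 a b)

  positive : ∀ i → 0 ℕ.< lookup d i
  positive zero       = s≤s z≤n
  positive (suc zero) = s≤s z≤n

  0-c≤0 : ∀ c → 0ℤ - + c ℤ.≤ 0ℤ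
  0-c≤0 zero    = +≤+ z≤n
  0-c≤0 (suc c) = -≤+

  zMatrix : IsZMatrix M
  zMatrix zero       zero       i≢j = ⊥-elim (i≢j refl)
  zMatrix zero       (suc zero) _   = 0-c≤0 a
  zMatrix (suc zero) zero       _   = 0-c≤0 b
  zMatrix (suc zero) (suc zero) i≢j = ⊥-elim (i≢j refl)

  properMinors : ∀ k → k ℕ.< 2 → (f : Fin k → Fin 2) → StrictlyIncreasing f →
    0ℤ ℤ.< det (principalSub M f)
  properMinors zero          _                   f _ = +<+ (s≤s z≤n)
  properMinors (suc zero)    _                   f _ with f zero
  ... | zero     = +<+ (s≤s z≤n)
  ... | suc zero = +<+ (s≤s z≤n)
  properMinors (suc (suc k)) (s≤s (s≤s ()))      f _

  det≥0 : 0ℤ ℤ.≤ det M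
  det≥0 = subst (0ℤ ℤ.≤_) (sym (det-diagMinus-L2 a b (suc m) (suc n))) (i≤j⇒0≤j-i (+≤+ ab≤d₁d₂))

RHSSet⇒AboveHyperbola : ∀ a b {x} → RHSSet a b x → AboveHyperbola (a ℕ.* b) x
RHSSet⇒AboveHyperbola a b (d , 1≤d , _ , refl) =
  1≤d , m≤m⊔n 1 ⌈ab/d⌉ , ≤-trans (≤-*-ceilDiv (a ℕ.* b) 1≤d) (*-monoʳ-≤ d (m≤n⊔m 1 ⌈ab/d⌉))
  where ⌈ab/d⌉ = ceilDiv (a ℕ.* b) d

AboveHyperbola⇒dominates-RHSSet : ∀ a b {x} → AboveHyperbola (a ℕ.* b) x →
  ∃ λ z → RHSSet a b z × z ≤ᵥ x
AboveHyperbola⇒dominates-RHSSet a b {d₁ ∷ d₂ ∷ []} (1≤d₁ , 1≤d₂ , ab≤d₁d₂)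
  with d₁ ℕ.≤? 1 ⊔ a ℕ.* b
... | yes d₁≤bound =
  _ , (d₁ , 1≤d₁ , d₁≤bound , refl) ,
  ≤-refl ∷ ⊔-lub 1≤d₂ (ceilDiv-least (a ℕ.* b) 1≤d₁ d₂ ab≤d₁d₂) ∷ []
... | no d₁≰bound =
  _ , (bound , 1≤bound , ≤-refl , refl) ,
  <⇒≤ (≰⇒> d₁≰bound) ∷ ⊔-lub 1≤d₂ (≤-trans ⌈ab/bound⌉≤1 1≤d₂) ∷ []
  where
  bound = 1 ⊔ a ℕ.* b
  1≤bound : 1 ℕ.≤ bound
  1≤bound = m≤m⊔n 1 (a ℕ.* b)
  ⌈ab/bound⌉≤1 : ceilDiv (a ℕ.* b) bound ℕ.≤ 1
  ⌈ab/bound⌉≤1 = ceilDiv-least (a ℕ.* b) 1≤bound 1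
    (subst (a ℕ.* b ℕ.≤_) (sym (*-identityʳ bound)) (m≤n⊔m 1 (a ℕ.* b)))

lemma3p2 : (a b : ℕ) → (x : Vec ℕ 2) →
    (Min (D≥0 (L2 a b)) x → Min (RHSSet a b) x) × (Min (RHSSet a b) x → Min (D≥0 (L2 a b)) x)
lemma3p2 a b =
  Min-cofinal (λ r → AboveHyperbola⇒D≥0-L2 a b (RHSSet⇒AboveHyperbola a b r))
              (λ s → AboveHyperbola⇒dominates-RHSSet a b (D≥0-L2⇒AboveHyperbola a b s))
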